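{- Let $F_0(x_1,\dots,x_{n-1})$ and $F_1(x_1,\dots,x_{n-1})$ be arbitrary hazard-free DeMorgan circuits and $x_n$ a new variable. Then the circuit $$F(x_1,\dots,x_n)=\bar x_n\cdot F_0\lor x_n\cdot F_1\lor F_0\cdot F_1$$ is hazard-free.
   Context: A DeMorgan circuit has fan-in-2 AND/OR gates and inputs $0,1,x_i,\bar x_i$ ($\cdot$ denotes AND). Ternary logic on $\{0,\mathfrak u,1\}$ ($\mathfrak u=1/2$): AND $=\min$, OR $=\max$, NOT $=1-x$; a circuit thus computes a function on ternary vectors. A circuit $F$ has a hazard at $\alpha\in\{0,\mathfrak u,1\}^n$ if $F$ takes the same value on all Boolean vectors obtained from $\alpha$ by replacing each $\mathfrak u$ by $0$ or $1$, yet $F(\alpha)=\mathfrak u$; it is hazard-free if it has no hazard at any $\alpha$. -}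

module Defs where

open import Data.Nat using (ℕ; suc)
open import Data.Fin using (Fin; inject₁; fromℕ)
open import Data.Product using (∃; _×_)
open import Relation.Binary.PropositionalEquality using (_≡_)
open import Relation.Nullary using (¬_)

-- Ternary values {0, u, 1}, ordered 0 < u < 1
data T : Set where
  t0 tu t1 : T

_∧ₜ_ : T → T → T
t0 ∧ₜ y = t0
tu ∧ₜ t0 = t0
tu ∧ₜ tu = tu
tu ∧ₜ t1 = tu
t1 ∧ₜ y = y

_∨ₜ_ : T → T → T
t0 ∨ₜ y = y
tu ∨ₜ t0 = tu
tu ∨ₜ tu = tu
tu ∨ₜ t1 = t1
t1 ∨ₜ y = t1

¬ₜ : T → T
¬ₜ t0 = t1
¬ₜ tu = tu
¬ₜ t1 = t0

data Refines : T → T → Set where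
  r0  : Refines t0 t0
  r1  : Refines t1 t1
  ru0 : Refines tu t0
  ru1 : Refines tu t1

data Circuit (n : ℕ) : Set where
  const0 const1 : Circuit n
  var negvar    : Fin n → Circuit n
  _∧ᶜ_ _∨ᶜ_     : Circuit n → Circuit n → Circuit n

infixr 7 _∧ᶜ_
infixr 6 _∨ᶜ_

eval : ∀ {n} → Circuit n → (Fin n → T) → T
eval const0 α = t0
eval const1 α = t1
eval (var i) α = α i
eval (negvar i) α = ¬ₜ (α i)
eval (F ∧ᶜ G) α = eval F α ∧ₜ eval G α
eval (F ∨ᶜ G) α = eval F α ∨ₜ eval G α

Resolution : ∀ {n} → (Fin n → T) → (Fin n → T) → Set
Resolution α β = ∀ i → Refines (α i) (β i)

HasHazard : ∀ {n} → Circuit n → (Fin n → T) → Set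
HasHazard F α =
  ∃ (λ b → ∀ β → Resolution α β → eval F β ≡ b) × eval F α ≡ tu

HazardFree : ∀ {n} → Circuit n → Set
HazardFree F = ∀ α → ¬ HasHazard F α

lift : ∀ {m} → Circuit m → Circuit (suc m)
lift const0 = const0
lift const1 = const1
lift (var i) = var (inject₁ i)
lift (negvar i) = negvar (inject₁ i)
lift (F ∧ᶜ G) = lift F ∧ᶜ lift G
lift (F ∨ᶜ G) = lift F ∨ᶜ lift G

newVar : (m : ℕ) → Fin (suc m)
newVar m = fromℕ m

combine : ∀ {m} → Circuit m → Circuit m → Circuit (suc m)
combine {m} F₀ F₁ =
  ((negvar (newVar m) ∧ᶜ lift F₀) ∨ᶜ (var (newVar m) ∧ᶜ lift F₁)) ∨ᶜ (lift F₀ ∧ᶜ lift F₁)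

-- Let a be the value of x_n at α and α' the restriction of α to x_1..x_{n-1}.
-- For Boolean c the circuit F evaluates to F_c on (α', c), so if F is constant
-- on the resolutions of α then so is F_c for every resolution c of a. If a is
-- Boolean, F(α) = F_a(α') and a hazard of F is one of F_a. If a = u, both F_0
-- and F_1 are constant with the same value b on the resolutions of α', hence
-- take the value b at α' by hazard-freeness; the consensus term F_0 · F_1 then
-- forces F(α) = b, which is not u.
module Submission where

open import Defs
open import Data.Nat using (ℕ; suc)
open import Data.Fin using (Fin; zero; suc; inject₁; fromℕ; punchIn; punchOut; _≟_)
open import Data.Fin.Properties using (punchIn-punchOut)
open import Data.Vec.Functional using (init; last; insertAt; removeAt)
open import Data.Vec.Functional.Properties using (insertAt-lookup; insertAt-punchIn)
open import Data.Product using (∃; _,_)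
open import Relation.Nullary using (yes; no; contradiction)
open import Relation.Binary.PropositionalEquality

private
  variable
    n : ℕ
    x x′ y y′ : T

∧ₜ-refines : Refines x x′ → Refines y y′ → Refines (x ∧ₜ y) (x′ ∧ₜ y′)
∧ₜ-refines r0  _   = r0
∧ₜ-refines r1  q   = q
∧ₜ-refines ru0 r0  = r0
∧ₜ-refines ru0 r1  = ru0
∧ₜ-refines ru0 ru0 = ru0
∧ₜ-refines ru0 ru1 = ru0
∧ₜ-refines ru1 r0  = r0
∧ₜ-refines ru1 r1  = ru1
∧ₜ-refines ru1 ru0 = ru0
∧ₜ-refines ru1 ru1 = ru1

∨ₜ-refines : Refines x x′ → Refines y y′ → Refines (x ∨ₜ y) (x′ ∨ₜ y′)
∨ₜ-refines r0  q   = q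
∨ₜ-refines r1  _   = r1
∨ₜ-refines ru0 r0  = ru0
∨ₜ-refines ru0 r1  = r1
∨ₜ-refines ru0 ru0 = ru0
∨ₜ-refines ru0 ru1 = ru1
∨ₜ-refines ru1 r0  = ru1
∨ₜ-refines ru1 r1  = r1
∨ₜ-refines ru1 ru0 = ru1
∨ₜ-refines ru1 ru1 = ru1

¬ₜ-refines : Refines x x′ → Refines (¬ₜ x) (¬ₜ x′)
¬ₜ-refines r0  = r1
¬ₜ-refines r1  = r0
¬ₜ-refines ru0 = ru1
¬ₜ-refines ru1 = ru0

refines-≢tu⇒≡ : Refines x y → x ≢ tu → x ≡ y
refines-≢tu⇒≡ r0  _    = refl
refines-≢tu⇒≡ r1  _    = refl
refines-≢tu⇒≡ ru0 x≢tu = contradiction refl x≢tu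
refines-≢tu⇒≡ ru1 x≢tu = contradiction refl x≢tu

ConstantOn : Circuit n → (Fin n → T) → T → Set
ConstantOn F α b = ∀ β → Resolution α β → eval F β ≡ b

eval-refines : ∀ (F : Circuit n) {α β} → Resolution α β → Refines (eval F α) (eval F β)
eval-refines const0     r = r0
eval-refines const1     r = r1
eval-refines (var i)    r = r i
eval-refines (negvar i) r = ¬ₜ-refines (r i)
eval-refines (F ∧ᶜ G)   r = ∧ₜ-refines (eval-refines F r) (eval-refines G r)
eval-refines (F ∨ᶜ G)   r = ∨ₜ-refines (eval-refines F r) (eval-refines G r)

eval-cong : ∀ (F : Circuit n) {α β} → (∀ i → α i ≡ β i) → eval F α ≡ eval F β
eval-cong const0     e = refl
eval-cong const1     e = refl
eval-cong (var i)    e = e i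
eval-cong (negvar i) e = cong ¬ₜ (e i)
eval-cong (F ∧ᶜ G)   e = cong₂ _∧ₜ_ (eval-cong F e) (eval-cong G e)
eval-cong (F ∨ᶜ G)   e = cong₂ _∨ₜ_ (eval-cong F e) (eval-cong G e)

eval-lift : ∀ (F : Circuit n) α → eval (lift F) α ≡ eval F (init α)
eval-lift const0     α = refl
eval-lift const1     α = refl
eval-lift (var i)    α = refl
eval-lift (negvar i) α = refl
eval-lift (F ∧ᶜ G)   α = cong₂ _∧ₜ_ (eval-lift F α) (eval-lift G α)
eval-lift (F ∨ᶜ G)   α = cong₂ _∨ₜ_ (eval-lift F α) (eval-lift G α)

resolution-exists : ∀ (α : Fin n → T) → ∃ (Resolution α)
resolution-exists α = (λ i → round (α i)) , (λ i → refines-round (α i))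
  where
  round : T → T
  round t1 = t1
  round _  = t0
  refines-round : ∀ x → Refines x (round x)
  refines-round t0 = r0
  refines-round tu = ru0
  refines-round t1 = r1

hazardFree-constant : ∀ (F : Circuit n) α {b} → HazardFree F → ConstantOn F α b → eval F α ≡ b
hazardFree-constant F α {b} hf const
  with β , α⇝β ← resolution-exists α
  = trans (refines-≢tu⇒≡ (eval-refines F α⇝β) (λ hazard → hf α ((b , const) , hazard)))
          (const β α⇝β)

punchIn-fromℕ : ∀ (i : Fin n) → punchIn (fromℕ n) i ≡ inject₁ i
punchIn-fromℕ zero    = refl
punchIn-fromℕ (suc i) = cong suc (punchIn-fromℕ i)

insertAt-resolution : ∀ {α : Fin (suc n) → T} {β c} p →
  Resolution (removeAt α p) β → Refines (α p) c → Resolution α (insertAt β p c)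
insertAt-resolution {α = α} {β} {c} p α⇝β αp⇝c i with p ≟ i
... | yes refl = subst (Refines (α p)) (sym (insertAt-lookup β p c)) αp⇝c
... | no p≢i   = subst (λ k → Refines (α k) (insertAt β p c k)) (punchIn-punchOut p≢i)
  (subst (Refines (α (punchIn p j))) (sym (insertAt-punchIn β p c j)) (α⇝β j))
  where j = punchOut p≢i

mux : T → T → T → T
mux c x y = ((¬ₜ c ∧ₜ x) ∨ₜ (c ∧ₜ y)) ∨ₜ (x ∧ₜ y)

mux-t0 : ∀ x y → mux t0 x y ≡ x
mux-t0 t0 y  = refl
mux-t0 tu t0 = refl
mux-t0 tu tu = refl
mux-t0 tu t1 = refl
mux-t0 t1 y  = refl

mux-t1 : ∀ x y → mux t1 x y ≡ y
mux-t1 t0 t0 = refl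
mux-t1 t0 tu = refl
mux-t1 t0 t1 = refl
mux-t1 tu t0 = refl
mux-t1 tu tu = refl
mux-t1 tu t1 = refl
mux-t1 t1 t0 = refl
mux-t1 t1 tu = refl
mux-t1 t1 t1 = refl

mux-diagonal : ∀ c x → mux c x x ≡ x
mux-diagonal t0 x  = mux-t0 x x
mux-diagonal t1 x  = mux-t1 x x
mux-diagonal tu t0 = refl
mux-diagonal tu tu = refl
mux-diagonal tu t1 = refl

module _ {m : ℕ} (F₀ F₁ : Circuit m) where

  eval-combine : ∀ α → eval (combine F₀ F₁) α ≡ mux (last α) (eval F₀ (init α)) (eval F₁ (init α))
  eval-combine α = cong₂ (mux (last α)) (eval-lift F₀ α) (eval-lift F₁ α)

  eval-combine-insertAt : ∀ β c →
    eval (combine F₀ F₁) (insertAt β (fromℕ m) c) ≡ mux c (eval F₀ β) (eval F₁ β)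
  eval-combine-insertAt β c = begin
    eval (combine F₀ F₁) γ                            ≡⟨ eval-combine γ ⟩
    mux (last γ) (eval F₀ (init γ)) (eval F₁ (init γ)) ≡⟨ cong₃ (insertAt-lookup β (fromℕ m) c)
                                                                (eval-cong F₀ init-γ) (eval-cong F₁ init-γ) ⟩
    mux c (eval F₀ β) (eval F₁ β)                      ∎
    where
    open ≡-Reasoning
    γ = insertAt β (fromℕ m) c
    init-γ : ∀ i → init γ i ≡ β i
    init-γ i = trans (cong γ (sym (punchIn-fromℕ i))) (insertAt-punchIn β (fromℕ m) c i)
    cong₃ : ∀ {c c′ x x′ y y′} → c ≡ c′ → x ≡ x′ → y ≡ y′ → mux c x y ≡ mux c′ x′ y′
    cong₃ refl refl refl = refl

  constantOn-cofactor : ∀ {α b c} → ConstantOn (combine F₀ F₁) α b → Refines (last α) c →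
    ∀ β → Resolution (init α) β → mux c (eval F₀ β) (eval F₁ β) ≡ b
  constantOn-cofactor {α} {b} {c} const αₘ⇝c β α′⇝β =
    trans (sym (eval-combine-insertAt β c))
          (const _ (insertAt-resolution (fromℕ m) α⇝β αₘ⇝c))
    where
    α⇝β : Resolution (removeAt α (fromℕ m)) β
    α⇝β i = subst (λ k → Refines (α k) (β i)) (sym (punchIn-fromℕ i)) (α′⇝β i)

  constantOn-cofactor₀ : ∀ {α b} → ConstantOn (combine F₀ F₁) α b → Refines (last α) t0 →
    ConstantOn F₀ (init α) b
  constantOn-cofactor₀ const αₘ⇝t0 β α′⇝β =
    trans (sym (mux-t0 _ _)) (constantOn-cofactor const αₘ⇝t0 β α′⇝β)

  constantOn-cofactor₁ : ∀ {α b} → ConstantOn (combine F₀ F₁) α b → Refines (last α) t1 →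
    ConstantOn F₁ (init α) b
  constantOn-cofactor₁ const αₘ⇝t1 β α′⇝β =
    trans (sym (mux-t1 _ _)) (constantOn-cofactor const αₘ⇝t1 β α′⇝β)

proposition3 : (m : ℕ) (F₀ F₁ : Circuit m) →
    HazardFree F₀ → HazardFree F₁ → HazardFree (combine F₀ F₁)
proposition3 m F₀ F₁ hf₀ hf₁ α ((b , const) , hazard)
  with last α
     | trans (sym (eval-combine F₀ F₁ α)) hazard
     | constantOn-cofactor₀ F₀ F₁ {α} const
     | constantOn-cofactor₁ F₀ F₁ {α} const
... | t0 | hazard′ | const₀ | _      = hf₀ (init α) ((b , const₀ r0) , trans (sym (mux-t0 _ _)) hazard′)
... | t1 | hazard′ | _      | const₁ = hf₁ (init α) ((b , const₁ r1) , trans (sym (mux-t1 _ _)) hazard′)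
... | tu | hazard′ | const₀ | const₁ = hf₀ α′ ((b , const₀ ru0) , f₀≡tu)
  where
  open ≡-Reasoning
  α′ = init α
  f₀ = eval F₀ α′
  f₁ = eval F₁ α′
  f₀≡tu : f₀ ≡ tu
  f₀≡tu = begin
    f₀            ≡⟨ mux-diagonal tu f₀ ⟨
    mux tu f₀ f₀  ≡⟨ cong (mux tu f₀) (trans (hazardFree-constant F₀ α′ hf₀ (const₀ ru0))
                                             (sym (hazardFree-constant F₁ α′ hf₁ (const₁ ru1)))) ⟩
    mux tu f₀ f₁  ≡⟨ hazard′ ⟩
    tu            ∎
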